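{- A permutation $\pi$ is DI-sortable if and only if $\pi$ avoids both patterns $3142$ and $3241$. Equivalently, the basis of the class of DI-sortable permutations is $\{3142,3241\}$.
   Context: The DI machine consists of two stacks in series: a decreasing stack D followed by an increasing stack I. A permutation $\pi=\pi(1)\cdots\pi(n)$ is processed from left to right, and the allowed moves are: push the next unread input entry onto the top of D; move the top entry of D onto the top of I; move the top entry of I to the end of the output. The entries of D must be decreasing when read from top to bottom (an entry may be placed on D only if it exceeds D's current top entry, or D is empty), and the entries of I must be increasing when read from top to bottom (an entry may be placed on I only if it is smaller than I's current top entry, or I is empty). A permutation $\pi$ of length $n$ is DI-sortable if some sequence of legal moves empties the input and both stacks and produces the output $12\cdots n$. A permutation $\pi$ contains a pattern $\sigma$ of length $k$ if some subsequence of $\pi$ of length $k$ is order-isomorphic to $\sigma$; otherwise $\pi$ avoids $\sigma$. The basis of a permutation class is the set of minimal permutations (under pattern containment) not in the class. -}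

module Defs where

open import Data.Nat using (ℕ; _<_; _>_)
open import Data.Fin using (Fin; toℕ; #_)
open import Data.Vec using (Vec; lookup; _∷_; []; toList)
open import Data.List using (List; []; _∷_; _++_; [_]; map; upTo)
open import Data.Product using (Σ; _×_)
open import Relation.Binary.PropositionalEquality using (_≡_)
open import Relation.Binary.Construct.Closure.ReflexiveTransitive using (Star)
open import Function.Bundles using (_⇔_)

-- A permutation of length n is an injective (hence bijective) map Fin n → Fin n,
-- π i being the entry in position i (values 0..n-1 stand for 1..n).

-- Configuration of the DI machine: remaining input, stack D (head = top),
-- stack I (head = top), output so far (in output order).
record Config : Set where
  constructor cfg
  field
    input  : List ℕ
    stackD : List ℕ
    stackI : List ℕ
    output : List ℕ

data CanPushD (x : ℕ) : List ℕ → Set where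
  emptyD : CanPushD x []
  aboveD : ∀ {t s} → x > t → CanPushD x (t ∷ s)

data CanPushI (x : ℕ) : List ℕ → Set where
  emptyI : CanPushI x []
  belowI : ∀ {t s} → x < t → CanPushI x (t ∷ s)

data Step : Config → Config → Set where
  inToD : ∀ {x inp d i out} → CanPushD x d →
          Step (cfg (x ∷ inp) d i out) (cfg inp (x ∷ d) i out)
  dToI  : ∀ {x inp d i out} → CanPushI x i →
          Step (cfg inp (x ∷ d) i out) (cfg inp d (x ∷ i) out)
  iToOut : ∀ {x inp d i out} →
          Step (cfg inp d (x ∷ i) out) (cfg inp d i (out ++ [ x ]))

word : ∀ {n} → (Fin n → Fin n) → List ℕ
word {n} π = map (λ i → toℕ (π i)) (Data.List.allFin n)
  where import Data.List

DISortable : ∀ {n} → (Fin n → Fin n) → Set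
DISortable {n} π = Star Step (cfg (word π) [] [] []) (cfg [] [] [] (upTo n))

Contains : ∀ {n k} → (Fin n → Fin n) → (Fin k → Fin k) → Set
Contains {n} {k} π σ =
  Σ (Fin k → Fin n) λ e →
    (∀ i j → toℕ i < toℕ j → toℕ (e i) < toℕ (e j)) ×
    (∀ i j → (toℕ (σ i) < toℕ (σ j)) ⇔ (toℕ (π (e i)) < toℕ (π (e j))))

Avoids : ∀ {n k} → (Fin n → Fin n) → (Fin k → Fin k) → Set
Avoids π σ = Contains π σ → Data.Empty.⊥
  where import Data.Empty

-- 3142 and 3241 (0-based values 2 0 3 1 and 2 1 3 0).
p3142 : Fin 4 → Fin 4
p3142 = lookup (# 2 ∷ # 0 ∷ # 3 ∷ # 1 ∷ [])

p3241 : Fin 4 → Fin 4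
p3241 = lookup (# 2 ∷ # 1 ∷ # 3 ∷ # 0 ∷ [])

-- Both patterns have one shape: entries c, x, d, y, in this order, with x < c < d
-- and y < c — an obstruction.  In a permutation an obstruction is an occurrence of
-- 3142 if x < y and of 3241 if y < x, so the theorem reduces to two facts about the
-- machine running on an arbitrary input word.
--   Necessity: no run that ends with a sorted output starts from a word with an
--   obstruction.  x cannot be pushed above c, so c reaches I before x is read; then
--   d must be pushed, can never move onto I above c, and blocks the push of y < d;
--   so c is output while the smaller y is unread.  This is tracked by "phases"
--   that persist until the machine commits an irreparable output inversion.
--   Sufficiency: on an obstruction-free word listing 0, …, n-1 a greedy strategy
--   succeeds.  Its invariant records why each entry s waiting on I was put there: a
--   smaller entry was read after s, or the next input was smaller.  Pushing an
--   entry h above s while the next output o < s is unread would then exhibit the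
--   obstruction s, x, h, o, so pushes never overtake I and the machine never blocks.
module Submission where

open import Defs
open import Data.Nat using (ℕ)
open import Data.Fin using (Fin)
open import Data.Product using (_×_)
open import Relation.Binary.PropositionalEquality using (_≡_)
open import Function.Definitions using (Injective)
open import Function.Bundles using (_⇔_)

open import Level using (0ℓ)
open import Function.Base using (id; _∘_)
open import Function.Bundles using (mk⇔; Equivalence)
open import Data.Nat as ℕ using (suc; _<_; _>_; _≤_; z≤n; z<s; s<s; _≟_; _<?_)
import Data.Nat.Properties as ℕₚ
open import Data.Fin as Fin using (toℕ; zero; suc; #_; fromℕ<; punchOut)
open import Data.Fin.Properties as Finₚ
  using (toℕ-injective; toℕ<n; toℕ-fromℕ<; punchOut-injective; injective⇒≤)
open import Data.Vec using (_∷_; []; lookup)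
open import Data.List using (List; []; _∷_; _++_; [_]; map; tabulate; allFin; drop; upTo)
open import Data.List.Properties using (map-tabulate; ++-assoc; upTo-∷ʳ)
open import Data.List.Membership.Propositional using (_∈_; _∉_)
open import Data.List.Membership.Propositional.Properties
  using (∈-allFin; ∈-++⁺ˡ; ∈-++⁺ʳ; ∈-++⁻; ∈-map⁺; ∈-map⁻)
open import Data.List.Relation.Unary.Any using (here; there)
open import Data.List.Relation.Unary.All as All using (All; []; _∷_)
import Data.List.Relation.Unary.All.Properties as Allₚ
open import Data.List.Relation.Unary.AllPairs using (AllPairs; []; _∷_)
open import Data.List.Relation.Unary.AllPairs.Properties using (tabulate⁺-<; applyUpTo⁺₁)
open import Data.List.Relation.Unary.Linked using ([-]; _∷_)
open import Data.List.Relation.Unary.Linked.Properties using (Linked⇒AllPairs)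
open import Data.List.Relation.Unary.Unique.Propositional {A = ℕ} using (Unique)
import Data.List.Relation.Unary.Unique.Propositional.Properties as Uniqueₚ
open import Data.List.Relation.Binary.Sublist.Propositional
  using (_⊆_; []; _∷_; _∷ʳ_; from∈; to∈; ⊆-refl)
open import Data.List.Relation.Binary.Sublist.Propositional.Properties
  using (All-resp-⊆; []⊆-universal; map⁺; ++⁺; ++⁺ʳ; ∷ˡ⁻) renaming (++⁺ˡ to ⊆-++⁺ˡ)
open import Data.List.Relation.Binary.Permutation.Propositional {A = ℕ} using (_↭_; ↭-sym; ↭⇒↭ₛ)
open import Data.List.Relation.Binary.Permutation.Propositional.Properties
  using (shift; ∈-resp-↭) renaming (++⁺ˡ to ↭-++⁺ˡ)
open import Data.List.Relation.Binary.Permutation.Setoid.Properties using (Unique-resp-↭)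
open import Data.Product using (Σ; ∃; _,_; proj₁; proj₂)
open import Data.Sum using (_⊎_; inj₁; inj₂) renaming ([_,_] to either)
open import Data.Empty using (⊥; ⊥-elim)
open import Relation.Nullary using (¬_; yes; no)
open import Relation.Binary.Core using (Rel)
open import Relation.Binary.Structures using (IsStrictPartialOrder)
open import Relation.Binary.Definitions using (Tri; tri<; tri≈; tri>)
open import Relation.Binary.PropositionalEquality
  using (_≢_; refl; sym; trans; cong; subst; subst₂; setoid)
open import Relation.Binary.Construct.Closure.ReflexiveTransitive using (Star; ε; _◅_; fold)

AllPairs-resp-⊆ : ∀ {A : Set} {R : Rel A 0ℓ} {xs ys : List A} →
                  xs ⊆ ys → AllPairs R ys → AllPairs R xs
AllPairs-resp-⊆ []         []       = []
AllPairs-resp-⊆ (_ ∷ʳ p)   (_ ∷ rs) = AllPairs-resp-⊆ p rs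
AllPairs-resp-⊆ (refl ∷ p) (r ∷ rs) = All-resp-⊆ p r ∷ AllPairs-resp-⊆ p rs

⊆-map⁻ : ∀ {A B : Set} (f : A → B) (xs : List A) {ys : List B} → ys ⊆ map f xs →
         Σ (List A) λ zs → zs ⊆ xs × map f zs ≡ ys
⊆-map⁻ f []       []         = [] , [] , refl
⊆-map⁻ f (x ∷ xs) (_ ∷ʳ p)   with ⊆-map⁻ f xs p
... | zs , zs⊆xs , refl = zs , x ∷ʳ zs⊆xs , refl
⊆-map⁻ f (x ∷ xs) (refl ∷ p) with ⊆-map⁻ f xs p
... | zs , zs⊆xs , refl = x ∷ zs , refl ∷ zs⊆xs , refl

module _ {A : Set} {_≺_ : Rel A 0ℓ} (strict : IsStrictPartialOrder _≡_ _≺_) where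
  open IsStrictPartialOrder strict using (irrefl) renaming (trans to ≺-trans)

  above-head : ∀ {z zs js} → All (z ≺_) js → All (_∈ z ∷ zs) js → All (_∈ zs) js
  above-head []           []                = []
  above-head (z≺j ∷ _)    (here refl ∷ _)   = ⊥-elim (irrefl refl z≺j)
  above-head (_ ∷ z≺js)   (there j∈ ∷ js∈)  = j∈ ∷ above-head z≺js js∈

  sorted-⊆ : ∀ {is zs : List A} → AllPairs _≺_ is → AllPairs _≺_ zs → All (_∈ zs) is → is ⊆ zs
  sorted-⊆ {[]}    _            _            []                 = []⊆-universal _
  sorted-⊆ {_ ∷ _} (i≺is ∷ is↑) (_ ∷ zs↑)    (here refl ∷ is∈)  =
    refl ∷ sorted-⊆ is↑ zs↑ (above-head i≺is is∈)
  sorted-⊆ {_ ∷ _} (i≺is ∷ is↑) (z≺zs ∷ zs↑) (there i∈zs ∷ is∈) =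
    _ ∷ʳ sorted-⊆ (i≺is ∷ is↑) zs↑
                   (i∈zs ∷ above-head (All.map (≺-trans (All.lookup z≺zs i∈zs)) i≺is) is∈)

tabulate⁻-< : ∀ {A : Set} {R : Rel A 0ℓ} {k} {f : Fin k → A} → AllPairs R (tabulate f) →
              ∀ {i j} → i Fin.< j → R (f i) (f j)
tabulate⁻-< {k = ℕ.suc _} (f0≺ ∷ _)  {zero}  {suc j} _ = Allₚ.tabulate⁻ f0≺ j
tabulate⁻-< {k = ℕ.suc _} (_ ∷ sorted) {suc i} {suc j} (ℕ.s≤s i<j) = tabulate⁻-< sorted i<j

entry : ∀ {n} → (Fin n → Fin n) → Fin n → ℕ
entry π i = toℕ (π i)

occurrence : ∀ {n k} (π : Fin n → Fin n) (σ : Fin k → Fin k) (e : Fin k → Fin n) (b : Fin k → ℕ) →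
             (∀ {i j} → i Fin.< j → e i Fin.< e j) → (∀ {i j} → i Fin.< j → b i < b j) →
             (∀ i → entry π (e i) ≡ b (σ i)) → Contains π σ
occurrence π σ e b e↑ b↑ e≡b∘σ = e , (λ _ _ → e↑) , λ i j → mk⇔ (preserve i j) (reflect i j)
  where
  preserve : ∀ i j → toℕ (σ i) < toℕ (σ j) → entry π (e i) < entry π (e j)
  preserve i j σi<σj = subst₂ _<_ (sym (e≡b∘σ i)) (sym (e≡b∘σ j)) (b↑ σi<σj)

  reflect : ∀ i j → entry π (e i) < entry π (e j) → toℕ (σ i) < toℕ (σ j)
  reflect i j ei<ej with Finₚ.<-cmp (σ i) (σ j)
  ... | tri< σi<σj _ _ = σi<σj
  ... | tri≈ _ σi≡σj _ =
    ⊥-elim (ℕₚ.<-irrefl (trans (e≡b∘σ i) (trans (cong b σi≡σj) (sym (e≡b∘σ j)))) ei<ej)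
  ... | tri> _ _ σj<σi = ⊥-elim (ℕₚ.<-asym ei<ej (preserve j i σj<σi))

occurrence-⊆-word : ∀ {n k} (π : Fin n → Fin n) (e : Fin k → Fin n) →
                    (∀ {i j} → i Fin.< j → e i Fin.< e j) → tabulate (entry π ∘ e) ⊆ word π
occurrence-⊆-word {n} π e e↑ =
  subst (_⊆ word π) (map-tabulate e (entry π)) (map⁺ (entry π) positions⊆allFin)
  where
  positions⊆allFin : tabulate e ⊆ allFin n
  positions⊆allFin = sorted-⊆ Finₚ.<-isStrictPartialOrder (tabulate⁺-< e↑) (tabulate⁺-< id)
                       (Allₚ.tabulate⁺ (λ i → ∈-allFin (e i)))

record Obstruction (w : List ℕ) : Set where
  constructor obstruction
  field
    c x d y : ℕ
    x<c     : x < c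
    c<d     : c < d
    y<c     : y < c
    occurs  : c ∷ x ∷ d ∷ y ∷ [] ⊆ w

pattern⇒obstruction : ∀ {n} (π : Fin n → Fin n) (σ : Fin 4 → Fin 4) →
  toℕ (σ (# 1)) < toℕ (σ (# 0)) → toℕ (σ (# 0)) < toℕ (σ (# 2)) → toℕ (σ (# 3)) < toℕ (σ (# 0)) →
  Contains π σ → Obstruction (word π)
pattern⇒obstruction π σ σ₁<σ₀ σ₀<σ₂ σ₃<σ₀ (e , e↑ , order) =
  obstruction _ _ _ _ (agrees σ₁<σ₀) (agrees σ₀<σ₂) (agrees σ₃<σ₀) (occurrence-⊆-word π e (e↑ _ _))
  where
  agrees : ∀ {i j} → toℕ (σ i) < toℕ (σ j) → entry π (e i) < entry π (e j)
  agrees = Equivalence.to (order _ _)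

-- In a permutation an obstruction c x d y is an occurrence of 3142 if x < y and of
-- 3241 if y < x; x = y is impossible as the two entries sit in different positions.
obstruction⇒pattern : ∀ {n} (π : Fin n → Fin n) → Injective _≡_ _≡_ π →
                      Obstruction (word π) → Contains π p3142 ⊎ Contains π p3241
obstruction⇒pattern {n} π π-inj (obstruction c x d y x<c c<d y<c occ)
  with ⊆-map⁻ (entry π) (allFin n) occ
... | p₀ ∷ p₁ ∷ p₂ ∷ p₃ ∷ [] , ps⊆allFin , refl = by-cases (ℕₚ.<-cmp x y)
  where
  e : Fin 4 → Fin n
  e = lookup (p₀ ∷ p₁ ∷ p₂ ∷ p₃ ∷ [])

  e↑ : ∀ {i j} → i Fin.< j → e i Fin.< e j
  e↑ = tabulate⁻-< (AllPairs-resp-⊆ ps⊆allFin (tabulate⁺-< id))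

  increasing : ∀ {a b c d} → a < b → b < c → c < d → ∀ {i j} → i Fin.< j →
               lookup (a ∷ b ∷ c ∷ d ∷ []) i < lookup (a ∷ b ∷ c ∷ d ∷ []) j
  increasing {a} {b} {c} {d} a<b b<c c<d =
    tabulate⁻-< {f = lookup (a ∷ b ∷ c ∷ d ∷ [])} (Linked⇒AllPairs ℕₚ.<-trans (a<b ∷ b<c ∷ c<d ∷ [-]))

  by-cases : Tri (x < y) (x ≡ y) (y < x) → Contains π p3142 ⊎ Contains π p3241
  by-cases (tri< x<y _ _) = inj₁ (occurrence π p3142 e _ e↑ (increasing x<y y<c c<d)
    λ { zero → refl ; (suc zero) → refl ; (suc (suc zero)) → refl ; (suc (suc (suc zero))) → refl })
  by-cases (tri≈ _ x≡y _) = ⊥-elim (Finₚ.<-irrefl (π-inj (toℕ-injective x≡y)) (e↑ {# 1} {# 3} (s<s z<s)))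
  by-cases (tri> _ _ y<x) = inj₂ (occurrence π p3241 e _ e↑ (increasing y<x x<c c<d)
    λ { zero → refl ; (suc zero) → refl ; (suc (suc zero)) → refl ; (suc (suc (suc zero))) → refl })

push-D-above : ∀ {h D} → CanPushD h D → AllPairs _>_ D → All (_< h) D
push-D-above emptyD       []           = []
push-D-above (aboveD t<h) (t>D ∷ _) = t<h ∷ All.map (λ a<t → ℕₚ.<-trans a<t t<h) t>D

push-I-below : ∀ {t I} → CanPushI t I → AllPairs _<_ I → All (t <_) I
push-I-below emptyI       []           = []
push-I-below (belowI t<s) (s<I ∷ _) = t<s ∷ All.map (ℕₚ.<-trans t<s) s<I

StacksSorted : Config → Set
StacksSorted (cfg _ D I _) = AllPairs _>_ D × AllPairs _<_ I

sorted-step : ∀ {k k′} → Step k k′ → StacksSorted k → StacksSorted k′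
sorted-step (inToD push) (D↓ , I↑)       = push-D-above push D↓ ∷ D↓ , I↑
sorted-step (dToI push)  ((_ ∷ D↓) , I↑) = D↓ , push-I-below push I↑ ∷ I↑
sorted-step iToOut       (D↓ , (_ ∷ I↑)) = D↓ , I↑

push-↭ : ∀ h inp D I → I ++ D ++ (h ∷ inp) ↭ I ++ (h ∷ D) ++ inp
push-↭ h inp D I = ↭-++⁺ˡ I (shift h D inp)

move-↭ : ∀ t inp D I → I ++ (t ∷ D) ++ inp ↭ (t ∷ I) ++ D ++ inp
move-↭ t inp D I = shift t I (D ++ inp)

∈⇒⊆-snoc : ∀ {u : ℕ} (t : ℕ) {out : List ℕ} → u ∈ out → u ∷ t ∷ [] ⊆ out ++ [ t ]
∈⇒⊆-snoc t u∈out = ++⁺ (from∈ u∈out) ⊆-refl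

-- The machine has committed an irreparable mistake: the output lists some u before
-- a smaller v, or some u has been output while a smaller v is still held.
data Inverted : Config → Set where
  inverted-output  : ∀ {u v inp D I out} → v < u → u ∷ v ∷ [] ⊆ out → Inverted (cfg inp D I out)
  output-too-early : ∀ {u v inp D I out} → v < u → u ∈ out → v ∈ I ++ D ++ inp →
                     Inverted (cfg inp D I out)

inverted-step : ∀ {k k′} → Step k k′ → Inverted k → Inverted k′
inverted-step (inToD _) (inverted-output v<u uv⊆out) = inverted-output v<u uv⊆out
inverted-step (dToI _)  (inverted-output v<u uv⊆out) = inverted-output v<u uv⊆out
inverted-step iToOut    (inverted-output v<u uv⊆out) = inverted-output v<u (++⁺ʳ _ uv⊆out)
inverted-step {cfg (h ∷ inp) D I _} (inToD _) (output-too-early v<u u∈out v∈held) =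
  output-too-early v<u u∈out (∈-resp-↭ (push-↭ h inp D I) v∈held)
inverted-step {cfg inp (t ∷ D) I _} (dToI _) (output-too-early v<u u∈out v∈held) =
  output-too-early v<u u∈out (∈-resp-↭ (move-↭ t inp D I) v∈held)
inverted-step iToOut (output-too-early v<u u∈out (here refl)) = inverted-output v<u (∈⇒⊆-snoc _ u∈out)
inverted-step iToOut (output-too-early v<u u∈out (there v∈held)) =
  output-too-early v<u (∈-++⁺ˡ u∈out) v∈held

¬inverted-final : ∀ {out} → AllPairs _<_ out → ¬ Inverted (cfg [] [] [] out)
¬inverted-final out↑ (inverted-output v<u uv⊆out) with AllPairs-resp-⊆ uv⊆out out↑
... | (u<v ∷ []) ∷ _ = ℕₚ.<-asym u<v v<u
¬inverted-final out↑ (output-too-early _ _ ())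

module Necessity (c x d y : ℕ) (x<c : x < c) (c<d : c < d) (y<c : y < c) where

  -- How far the obstruction has been processed, without any mistake so far.
  data Phase : Config → Set where
    unread    : ∀ {inp D I out} → c ∷ x ∷ d ∷ y ∷ [] ⊆ inp → Phase (cfg inp D I out)
    c-on-D    : ∀ {inp D I out} → c ∈ D → x ∷ d ∷ y ∷ [] ⊆ inp → Phase (cfg inp D I out)
    c-on-I    : ∀ {inp D I out} → c ∈ I → d ∷ y ∷ [] ⊆ inp → Phase (cfg inp D I out)
    d-on-D    : ∀ {inp D I out} → c ∈ I → d ∈ D → y ∈ inp → Phase (cfg inp D I out)

  Progress : Config → Set
  Progress k = Inverted k ⊎ Phase k

  phase-step : ∀ {k k′} → Step k k′ → StacksSorted k → Phase k → Progress k′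
  phase-step (inToD _) _ (unread (_ ∷ʳ s))  = inj₂ (unread s)
  phase-step (inToD _) _ (unread (refl ∷ s)) = inj₂ (c-on-D (here refl) s)
  phase-step (inToD _) _ (c-on-D c∈D (_ ∷ʳ s)) = inj₂ (c-on-D (there c∈D) s)
  phase-step (inToD push) (D↓ , _) (c-on-D c∈D (refl ∷ _)) =
    ⊥-elim (ℕₚ.<-asym x<c (All.lookup (push-D-above push D↓) c∈D))
  phase-step (inToD _) _ (c-on-I c∈I (_ ∷ʳ s)) = inj₂ (c-on-I c∈I s)
  phase-step (inToD _) _ (c-on-I c∈I (refl ∷ s)) = inj₂ (d-on-D c∈I (here refl) (to∈ s))
  phase-step (inToD push) (D↓ , _) (d-on-D _ d∈D (here refl)) =
    ⊥-elim (ℕₚ.<-asym (ℕₚ.<-trans y<c c<d) (All.lookup (push-D-above push D↓) d∈D))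
  phase-step (inToD _) _ (d-on-D c∈I d∈D (there y∈inp)) = inj₂ (d-on-D c∈I (there d∈D) y∈inp)
  phase-step (dToI _) _ (unread s) = inj₂ (unread s)
  phase-step (dToI _) _ (c-on-D (here refl) s) = inj₂ (c-on-I (here refl) (∷ˡ⁻ s))
  phase-step (dToI _) _ (c-on-D (there c∈D) s) = inj₂ (c-on-D c∈D s)
  phase-step (dToI _) _ (c-on-I c∈I s) = inj₂ (c-on-I (there c∈I) s)
  phase-step (dToI push) (_ , I↑) (d-on-D c∈I (here refl) _) =
    ⊥-elim (ℕₚ.<-asym c<d (All.lookup (push-I-below push I↑) c∈I))
  phase-step (dToI _) _ (d-on-D c∈I (there d∈D) y∈inp) = inj₂ (d-on-D (there c∈I) d∈D y∈inp)
  phase-step iToOut _ (unread s) = inj₂ (unread s)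
  phase-step iToOut _ (c-on-D c∈D s) = inj₂ (c-on-D c∈D s)
  phase-step {cfg inp D (_ ∷ I) out} iToOut _ (c-on-I (here refl) s) =
    inj₁ (output-too-early y<c (∈-++⁺ʳ out (here refl)) (∈-++⁺ʳ I (∈-++⁺ʳ D (to∈ (∷ˡ⁻ s)))))
  phase-step iToOut _ (c-on-I (there c∈I) s) = inj₂ (c-on-I c∈I s)
  phase-step {cfg inp D (_ ∷ I) out} iToOut _ (d-on-D (here refl) _ y∈inp) =
    inj₁ (output-too-early y<c (∈-++⁺ʳ out (here refl)) (∈-++⁺ʳ I (∈-++⁺ʳ D y∈inp)))
  phase-step iToOut _ (d-on-D (there c∈I) d∈D y∈inp) = inj₂ (d-on-D c∈I d∈D y∈inp)

  progress-run : ∀ {k k′} → Star Step k k′ →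
                 StacksSorted k × Progress k → StacksSorted k′ × Progress k′
  progress-run = fold (λ k k′ → StacksSorted k × Progress k → StacksSorted k′ × Progress k′)
                      (λ s continue → continue ∘ step s) id
    where
    step : ∀ {k k′} → Step k k′ → StacksSorted k × Progress k → StacksSorted k′ × Progress k′
    step s (sorted , inj₁ inverted) = sorted-step s sorted , inj₁ (inverted-step s inverted)
    step s (sorted , inj₂ phase)    = sorted-step s sorted , phase-step s sorted phase

  -- An empty machine with sorted output shows no progress: all phases need c, d or y held.
  ¬progress-final : ∀ {out} → AllPairs _<_ out → ¬ Progress (cfg [] [] [] out)
  ¬progress-final out↑ (inj₁ inverted) = ¬inverted-final out↑ inverted
  ¬progress-final _ (inj₂ (unread ()))
  ¬progress-final _ (inj₂ (c-on-D () _))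
  ¬progress-final _ (inj₂ (c-on-I () _))
  ¬progress-final _ (inj₂ (d-on-D () _ _))

obstruction-blocks : ∀ {w out} → Obstruction w → AllPairs _<_ out →
                     ¬ Star Step (cfg w [] [] []) (cfg [] [] [] out)
obstruction-blocks (obstruction c x d y x<c c<d y<c occ) out↑ run =
  ¬progress-final out↑ (proj₂ (progress-run run (([] , []) , inj₂ (unread occ))))
  where open Necessity c x d y x<c c<d y<c

sortable⇒unobstructed : ∀ {n} (π : Fin n → Fin n) → DISortable π → ¬ Obstruction (word π)
sortable⇒unobstructed {n} π run obs = obstruction-blocks obs (applyUpTo⁺₁ id n (λ i<j _ → i<j)) run

-- An injective map Fin n → Fin n is onto (pigeonhole): if i were missed, punching
-- i out would inject Fin n into Fin (n - 1).
injective⇒onto : ∀ {n} (f : Fin n → Fin n) → Injective _≡_ _≡_ f → ∀ i → ∃ λ j → f j ≡ i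
injective⇒onto {suc m} f f-inj i with Finₚ.any? (λ j → f j Finₚ.≟ i)
... | yes hit = hit
... | no  miss = ⊥-elim (ℕₚ.n≮n m (injective⇒≤ {f = skip-i} skip-i-injective))
  where
  missed : ∀ j → i ≢ f j
  missed j i≡fj = miss (j , sym i≡fj)
  skip-i : Fin (suc m) → Fin m
  skip-i j = punchOut (missed j)
  skip-i-injective : Injective _≡_ _≡_ skip-i
  skip-i-injective {j} {k} eq = f-inj (punchOut-injective (missed j) (missed k) eq)

record Enumerates (o n : ℕ) (xs : List ℕ) : Set where
  field
    o≤n      : o ≤ n
    unique   : Unique xs
    in-range : ∀ {v} → v ∈ xs → o ≤ v × v < n
    complete : ∀ {v} → o ≤ v → v < n → v ∈ xs

word-enumerates : ∀ {n} (π : Fin n → Fin n) → Injective _≡_ _≡_ π → Enumerates 0 n (word π)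
word-enumerates {n} π π-inj = record
  { o≤n      = z≤n
  ; unique   = Uniqueₚ.map⁺ (λ eq → π-inj (toℕ-injective eq)) (Uniqueₚ.allFin⁺ n)
  ; in-range = in-range
  ; complete = λ {v} _ v<n → complete v<n (injective⇒onto π π-inj (fromℕ< v<n))
  }
  where
  in-range : ∀ {v} → v ∈ word π → 0 ≤ v × v < n
  in-range v∈w with ∈-map⁻ (entry π) v∈w
  ... | i , _ , refl = z≤n , toℕ<n (π i)
  complete : ∀ {v} (v<n : v < n) → ∃ (λ j → π j ≡ fromℕ< v<n) → v ∈ word π
  complete v<n (j , πj≡v) =
    subst (_∈ word π) (trans (cong toℕ πj≡v) (toℕ-fromℕ< v<n)) (∈-map⁺ (entry π) (∈-allFin j))

enumerates-↭ : ∀ {o n xs ys} → xs ↭ ys → Enumerates o n xs → Enumerates o n ys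
enumerates-↭ xs↭ys e = record
  { o≤n      = o≤n
  ; unique   = Unique-resp-↭ (setoid ℕ) (↭⇒↭ₛ xs↭ys) unique
  ; in-range = λ v∈ys → in-range (∈-resp-↭ (↭-sym xs↭ys) v∈ys)
  ; complete = λ o≤v v<n → ∈-resp-↭ xs↭ys (complete o≤v v<n)
  }
  where open Enumerates e

enumerates-tail : ∀ {o n xs} → Enumerates o n (o ∷ xs) → Enumerates (suc o) n xs
enumerates-tail {o} {n} {xs} e = record
  { o≤n      = proj₂ (in-range (here refl))
  ; unique   = tail-unique unique
  ; in-range = λ v∈xs → ℕₚ.≤∧≢⇒< (proj₁ (in-range (there v∈xs))) (o≢ v∈xs) , proj₂ (in-range (there v∈xs))
  ; complete = complete′
  }
  where
  open Enumerates e
  tail-unique : Unique (o ∷ xs) → Unique xs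
  tail-unique (_ ∷ u) = u
  o≢ : ∀ {v} → v ∈ xs → o ≢ v
  o≢ v∈xs with unique
  ... | o∉xs ∷ _ = All.lookup o∉xs v∈xs
  complete′ : ∀ {v} → suc o ≤ v → v < n → v ∈ xs
  complete′ o<v v<n with complete (ℕₚ.<⇒≤ o<v) v<n
  ... | here refl  = ⊥-elim (ℕₚ.<-irrefl refl o<v)
  ... | there v∈xs = v∈xs

enumerates-[] : ∀ {o n} → Enumerates o n [] → o ≡ n
enumerates-[] e = ℕₚ.≤-antisym o≤n (ℕₚ.≮⇒≥ λ o<n → nothing-held (complete ℕₚ.≤-refl o<n))
  where
  open Enumerates e
  nothing-held : ∀ {v} → v ∈ [] → ⊥
  nothing-held ()

distinct : ∀ {u v xs} → Unique xs → u ∷ v ∷ [] ⊆ xs → u ≢ v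
distinct xs! uv⊆xs with AllPairs-resp-⊆ uv⊆xs xs!
... | (u≢v ∷ []) ∷ _ = u≢v

_IsTopOf_ : ℕ → List ℕ → Set
t IsTopOf []      = ⊥
t IsTopOf (s ∷ _) = t ≡ s

module Sufficiency (n : ℕ) (w : List ℕ) (unobstructed : ¬ Obstruction w) where

  -- Why an entry s may wait on I: a smaller entry was read after s, or s has been
  -- read and the next input is smaller.  Then pushing an entry h > s while a value
  -- below s is unread would complete an obstruction (see push-below-I).
  data Justified (rd : List ℕ) (s : ℕ) : List ℕ → Set where
    input-exhausted : Justified rd s []
    smaller-read    : ∀ {x inp} → x < s → s ∷ x ∷ [] ⊆ rd → Justified rd s inp
    smaller-next    : ∀ {h inp} → s ∈ rd → h < s → Justified rd s (h ∷ inp)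

  justified-read : ∀ {rd s h inp} → Justified rd s (h ∷ inp) → Justified (rd ++ [ h ]) s inp
  justified-read (smaller-read x<s sx⊆rd) = smaller-read x<s (++⁺ʳ _ sx⊆rd)
  justified-read (smaller-next s∈rd h<s)  = smaller-read h<s (∈⇒⊆-snoc _ s∈rd)

  -- The invariant of the greedy strategy, after reading the prefix rd of w, with o
  -- the next value to output: the machine holds exactly o, …, n-1; the stacks are
  -- sorted with D entirely below I; o is not buried under the top of D; and every
  -- entry of I other than o is justified.
  record Invariant (rd inp D I : List ℕ) (o : ℕ) : Set where
    field
      read-split   : rd ++ inp ≡ w
      holds        : Enumerates o n (I ++ D ++ inp)
      D↓           : AllPairs _>_ D
      I↑           : AllPairs _<_ I
      D<I          : All (λ a → All (a <_) I) D
      o-not-buried : o ∉ drop 1 D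
      D-read       : ∀ {v} → v ∈ D → v ∈ rd
      I-justified  : ∀ {s} → s ∈ I → s ≢ o → Justified rd s inp
  open Invariant

  -- The next output o is held, so when some s > o is on top of I, o is on D or unread.
  next-output-held : ∀ {rd inp D s I o} → Invariant rd inp D (s ∷ I) o → o < s → o ∈ D ++ inp
  next-output-held {inp = inp} {D} {s} {I} {o} inv o<s = not-on-I (∈-++⁻ (s ∷ I) o-held)
    where
    open Enumerates (holds inv)
    o-held : o ∈ (s ∷ I) ++ D ++ inp
    o-held = complete ℕₚ.≤-refl (ℕₚ.<-trans o<s (proj₂ (in-range (here refl))))
    not-on-I : o ∈ s ∷ I ⊎ o ∈ D ++ inp → o ∈ D ++ inp
    not-on-I (inj₂ o∈D++inp)      = o∈D++inp
    not-on-I (inj₁ (here refl))   = ⊥-elim (ℕₚ.<-irrefl refl o<s)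
    not-on-I (inj₁ (there o∈I))   with I↑ inv
    ... | s<I ∷ _ = ⊥-elim (ℕₚ.<-asym o<s (All.lookup s<I o∈I))

  above-next-output : ∀ {rd inp D s I o} → Invariant rd inp D (s ∷ I) o → o ≢ s → o < s
  above-next-output inv o≢s = ℕₚ.≤∧≢⇒< (proj₁ (Enumerates.in-range (holds inv) (here refl))) o≢s

  -- If o is neither on top of I nor in D, a next input h that may be
  -- pushed lies below all of I: were h above the top s of I, then o would be unread
  -- beyond h, and the justification of s would yield an obstruction s x h o in w.
  push-below-I : ∀ {rd h inp D I o} → Invariant rd (h ∷ inp) D I o → ¬ o IsTopOf I → o ∉ D →
                 All (h <_) I
  push-below-I {I = []} _ _ _ = []
  push-below-I {rd} {h} {inp} {D} {s ∷ I} {o} inv o≢s o∉D with I↑ inv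
  ... | s<I ∷ _ = h<s ∷ All.map (ℕₚ.<-trans h<s) s<I
    where
    o<s : o < s
    o<s = above-next-output inv o≢s
    o-unread : s < h → o ∈ inp
    o-unread s<h with ∈-++⁻ D (next-output-held inv o<s)
    ... | inj₁ o∈D           = ⊥-elim (o∉D o∈D)
    ... | inj₂ (here refl)   = ⊥-elim (ℕₚ.<-irrefl refl (ℕₚ.<-trans o<s s<h))
    ... | inj₂ (there o∈inp) = o∈inp
    h<s : h < s
    h<s with ℕₚ.<-cmp h s
    ... | tri< h<s _ _ = h<s
    ... | tri≈ _ h≡s _ = ⊥-elim (distinct (Enumerates.unique (holds inv)) sh⊆held (sym h≡s))
      where
      sh⊆held : s ∷ h ∷ [] ⊆ (s ∷ I) ++ D ++ h ∷ inp
      sh⊆held = refl ∷ ⊆-++⁺ˡ I (⊆-++⁺ˡ D (refl ∷ []⊆-universal inp))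
    ... | tri> _ _ s<h with I-justified inv (here refl) (λ s≡o → o≢s (sym s≡o))
    ...   | smaller-next _ h<s = ⊥-elim (ℕₚ.<-asym s<h h<s)
    ...   | smaller-read {x} x<s sx⊆rd = ⊥-elim (unobstructed (obstruction s x h o x<s s<h o<s sxho⊆w))
      where
      sxho⊆w : s ∷ x ∷ h ∷ o ∷ [] ⊆ w
      sxho⊆w = subst (_ ⊆_) (read-split inv) (++⁺ sx⊆rd (refl ∷ from∈ (o-unread s<h)))

  -- Outputting o: the rest of I stays justified (its entries exceed o), and D is
  -- empty since its entries would lie below o yet be held, so nothing is buried.
  output-inv : ∀ {rd inp D I o} → Invariant rd inp D (o ∷ I) o → Invariant rd inp D I (suc o)
  output-inv {rd} {inp} {D} {I} {o} inv = record
    { read-split   = read-split inv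
    ; holds        = enumerates-tail (holds inv)
    ; D↓           = D↓ inv
    ; I↑           = I-tail↑
    ; D<I          = All.map (λ { (_ ∷ a<I) → a<I }) (D<I inv)
    ; o-not-buried = nothing-buried D (D<I inv) λ a∈D → proj₁ (in-range (there (∈-++⁺ʳ I (∈-++⁺ˡ a∈D))))
    ; D-read       = D-read inv
    ; I-justified  = λ s∈I _ → I-justified inv (there s∈I) (λ s≡o → ℕₚ.<-irrefl (sym s≡o) (o<I s∈I))
    }
    where
    open Enumerates (holds inv)
    I-tail↑ : AllPairs _<_ I
    I-tail↑ with I↑ inv
    ... | _ ∷ I↑′ = I↑′
    o<I : ∀ {s} → s ∈ I → o < s
    o<I s∈I with I↑ inv
    ... | o<I ∷ _ = All.lookup o<I s∈I
    nothing-buried : ∀ D → All (λ a → All (a <_) (o ∷ I)) D → (∀ {a} → a ∈ D → o ≤ a) → suc o ∉ drop 1 D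
    nothing-buried []      _                 _   ()
    nothing-buried (t ∷ _) ((t<o ∷ _) ∷ _) o≤D _ = ℕₚ.<-irrefl refl (ℕₚ.<-≤-trans t<o (o≤D (here refl)))

  -- Moving the top t of D onto I is legal, since D lies below I.
  lift-legal : ∀ {rd inp t D I o} → Invariant rd inp (t ∷ D) I o → CanPushI t I
  lift-legal inv with D<I inv
  ... | [] ∷ _        = emptyI
  ... | (t<s ∷ _) ∷ _ = belowI t<s

  lift-inv : ∀ {rd inp t D I o} → Invariant rd inp (t ∷ D) I o → (t ≢ o → Justified rd t inp) →
             Invariant rd inp D (t ∷ I) o
  lift-inv {rd} {inp} {t} {D} {I} {o} inv t-justified with D↓ inv | D<I inv
  ... | t>D ∷ D↓′ | t<I ∷ D<I′ = record
    { read-split   = read-split inv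
    ; holds        = enumerates-↭ (move-↭ t inp D I) (holds inv)
    ; D↓           = D↓′
    ; I↑           = t<I ∷ I↑ inv
    ; D<I          = All.zipWith (λ (a<t , a<I) → a<t ∷ a<I) (t>D , D<I′)
    ; o-not-buried = unburied D (o-not-buried inv)
    ; D-read       = λ v∈D → D-read inv (there v∈D)
    ; I-justified  = justified
    }
    where
    unburied : ∀ D → o ∉ D → o ∉ drop 1 D
    unburied []      _   ()
    unburied (_ ∷ _) o∉D o∈D = o∉D (there o∈D)
    justified : ∀ {s} → s ∈ t ∷ I → s ≢ o → Justified rd s inp
    justified (here refl) = t-justified
    justified (there s∈I) = I-justified inv s∈I

  push-inv : ∀ {rd h inp D I o} → Invariant rd (h ∷ inp) D I o → CanPushD h D → All (h <_) I →
             o ∉ D → Invariant (rd ++ [ h ]) inp (h ∷ D) I o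
  push-inv {rd} {h} {inp} {D} {I} {o} inv legal h<I o∉D = record
    { read-split   = trans (++-assoc rd [ h ] inp) (read-split inv)
    ; holds        = enumerates-↭ (push-↭ h inp D I) (holds inv)
    ; D↓           = push-D-above legal (D↓ inv) ∷ D↓ inv
    ; I↑           = I↑ inv
    ; D<I          = h<I ∷ D<I inv
    ; o-not-buried = o∉D
    ; D-read       = read
    ; I-justified  = λ s∈I s≢o → justified-read (I-justified inv s∈I s≢o)
    }
    where
    read : ∀ {v} → v ∈ h ∷ D → v ∈ rd ++ [ h ]
    read (here refl) = ∈-++⁺ʳ rd (here refl)
    read (there v∈D) = ∈-++⁺ˡ (D-read inv v∈D)

  data Blocks (t : ℕ) : List ℕ → Set where
    no-input   : Blocks t []
    next-below : ∀ {h inp} → h < t → Blocks t (h ∷ inp)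

  blocking-justified : ∀ {rd inp t D I o} → Invariant rd inp (t ∷ D) I o → Blocks t inp →
                       Justified rd t inp
  blocking-justified _   no-input         = input-exhausted
  blocking-justified inv (next-below h<t) = smaller-next (D-read inv (here refl)) h<t

  -- The greedy strategy: output o if it is on top of I, else move o from the top of
  -- D, else push the next input if legal, else move the top of D onto I.
  data Choice (o : ℕ) : List ℕ → List ℕ → List ℕ → Set where
    output : ∀ {inp D I} → Choice o inp D (o ∷ I)
    lift-o : ∀ {inp D I} → Choice o inp (o ∷ D) I
    push   : ∀ {h inp D I} → ¬ o IsTopOf I → o ∉ D → CanPushD h D → Choice o (h ∷ inp) D I
    lift   : ∀ {inp t D I} → Blocks t inp → Choice o inp (t ∷ D) I
    done   : Choice o [] [] []

  -- The machine cannot hold only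
  -- I then, since o would have to be held beneath the top of I; and the top t of D
  -- never equals the next input h, the held entries being distinct.
  choose-input : ∀ {rd inp D I o} → Invariant rd inp D I o → ¬ o IsTopOf I → o ∉ D → Choice o inp D I
  choose-input {inp = []} {[]} {[]} _ _ _ = done
  choose-input {inp = []} {[]} {s ∷ I} {o} inv o≢s _
    with next-output-held inv (above-next-output inv o≢s)
  ... | ()
  choose-input {inp = []}    {_ ∷ _} _ _ _         = lift no-input
  choose-input {inp = _ ∷ _} {[]}    _ o≢top o∉D = push o≢top o∉D emptyD
  choose-input {inp = h ∷ inp} {t ∷ D} {I} inv o≢top o∉D with t <? h
  ... | yes t<h = push o≢top o∉D (aboveD t<h)
  ... | no  t≮h = lift (next-below (ℕₚ.≤∧≢⇒< (ℕₚ.≮⇒≥ t≮h) h≢t))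
    where
    h≢t : h ≢ t
    h≢t h≡t = distinct (Enumerates.unique (holds inv))
                (⊆-++⁺ˡ I (refl ∷ ⊆-++⁺ˡ D (refl ∷ []⊆-universal inp))) (sym h≡t)

  choose-D : ∀ {rd inp D I o} → Invariant rd inp D I o → ¬ o IsTopOf I → Choice o inp D I
  choose-D {D = []} inv o≢top = choose-input inv o≢top (λ ())
  choose-D {D = t ∷ D} {o = o} inv o≢top with o ≟ t
  ... | yes refl = lift-o
  ... | no  o≢t  = choose-input inv o≢top λ { (here o≡t) → o≢t o≡t ; (there o∈D) → o-not-buried inv o∈D }

  choose : ∀ {rd inp D I o} → Invariant rd inp D I o → Choice o inp D I
  choose {I = []} inv = choose-D inv (λ ())
  choose {I = s ∷ I} {o} inv with o ≟ s
  ... | yes refl = output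
  ... | no  o≢s  = choose-D inv o≢s

  -- Following the greedy choices from an invariant state sorts the rest.  Each step
  -- reads an input, or shortens D without reading, or shortens I leaving D and the input.
  sort-from : ∀ inp D I {rd o} → Invariant rd inp D I o → Choice o inp D I →
              Star Step (cfg inp D I (upTo o)) (cfg [] [] [] (upTo n))
  sort-from inp D (o ∷ I) {o = o} inv output =
    let inv′ = output-inv inv in
    iToOut ◅ subst (λ out → Star Step (cfg inp D I out) _) (sym (upTo-∷ʳ o))
                   (sort-from inp D I inv′ (choose inv′))
  sort-from inp (o ∷ D) I {o = o} inv lift-o =
    let inv′ = lift-inv inv (λ o≢o → ⊥-elim (o≢o refl)) in
    dToI (lift-legal inv) ◅ sort-from inp D (o ∷ I) inv′ (choose inv′)
  sort-from (h ∷ inp) D I inv (push o≢top o∉D legal) =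
    let inv′ = push-inv inv legal (push-below-I inv o≢top o∉D) o∉D in
    inToD legal ◅ sort-from inp (h ∷ D) I inv′ (choose inv′)
  sort-from inp (t ∷ D) I inv (lift blocks) =
    let inv′ = lift-inv inv (λ _ → blocking-justified inv blocks) in
    dToI (lift-legal inv) ◅ sort-from inp D (t ∷ I) inv′ (choose inv′)
  sort-from [] [] [] inv done =
    subst (λ m → Star Step _ (cfg [] [] [] (upTo m))) (enumerates-[] (holds inv)) ε

  sort : Enumerates 0 n w → Star Step (cfg w [] [] []) (cfg [] [] [] (upTo n))
  sort w-enumerates = sort-from w [] [] inv₀ (choose inv₀)
    where
    inv₀ : Invariant [] w [] [] 0
    inv₀ = record
      { read-split = refl ; holds = w-enumerates ; D↓ = [] ; I↑ = [] ; D<I = []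
      ; o-not-buried = λ () ; D-read = λ () ; I-justified = λ () }

theorem4 : (n : ℕ) → (π : Fin n → Fin n) → Injective _≡_ _≡_ π →
           DISortable π ⇔ (Avoids π p3142 × Avoids π p3241)
theorem4 n π π-inj = mk⇔ necessity sufficiency
  where
  necessity : DISortable π → Avoids π p3142 × Avoids π p3241
  necessity sortable =
    (sortable⇒unobstructed π sortable ∘ pattern⇒obstruction π p3142 z<s (s<s (s<s z<s)) (s<s z<s)) ,
    (sortable⇒unobstructed π sortable ∘ pattern⇒obstruction π p3241 (s<s z<s) (s<s (s<s z<s)) z<s)

  sufficiency : Avoids π p3142 × Avoids π p3241 → DISortable π
  sufficiency (avoids-3142 , avoids-3241) =
    Sufficiency.sort n (word π) unobstructed (word-enumerates π π-inj)
    where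
    unobstructed : ¬ Obstruction (word π)
    unobstructed = either avoids-3142 avoids-3241 ∘ obstruction⇒pattern π π-inj
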